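{- $K_3\vee P_4$ is $d_1$-choosable.
   Context: All graphs are finite and simple. A list assignment $L$ on $G$ assigns a finite set $L(v)\subseteq\mathbb{N}$ to each vertex; $G$ is $L$-colorable if there is a proper coloring $c$ with $c(v)\in L(v)$ for all $v$. For $f:V(G)\to\mathbb{N}$, $G$ is $f$-choosable if it is $L$-colorable for every $L$ with $|L(v)|=f(v)$ for all $v$. $G$ is $d_1$-choosable if it is $f$-choosable for $f(v)=d_G(v)-1$. $P_4$ is the path on $4$ vertices, $K_3$ the triangle, and $A\vee B$ the join. -}

module Defs where

open import Data.Bool using (Bool; true; false; not; _∧_; _∨_; if_then_else_; T)
open import Data.Nat using (ℕ; zero; suc; _+_; _∸_)
open import Data.Fin using (Fin; toℕ; splitAt)
open import Data.Sum using (_⊎_; inj₁; inj₂)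
open import Data.Product using (Σ; _×_)
open import Data.List using (List; length; map; allFin)
open import Data.Nat.ListAction using (sum)
open import Data.List.Membership.Propositional using (_∈_)
open import Data.List.Relation.Unary.Unique.Propositional using (Unique)
open import Relation.Binary.PropositionalEquality using (_≡_; _≢_)
open import Relation.Nullary.Decidable using (⌊_⌋)
import Data.Nat as ℕ
import Data.Fin as F

-- A (finite, simple) graph on vertex set Fin n, given by a Boolean adjacency
-- function.  All graphs constructed below are symmetric and loopless.
Graph : ℕ → Set
Graph n = Fin n → Fin n → Bool

degree : {n : ℕ} → Graph n → Fin n → ℕ
degree {n} G v = sum (map (λ u → if G v u then 1 else 0) (allFin n))

complete : (m : ℕ) → Graph m
complete m i j = not ⌊ i F.≟ j ⌋

path : (m : ℕ) → Graph m
path m i j = ⌊ suc (toℕ i) ℕ.≟ toℕ j ⌋ ∨ ⌊ suc (toℕ j) ℕ.≟ toℕ i ⌋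

join : {m n : ℕ} → Graph m → Graph n → Graph (m + n)
join {m} A B x y with splitAt m x | splitAt m y
... | inj₁ i | inj₁ j = A i j
... | inj₂ i | inj₂ j = B i j
... | inj₁ _ | inj₂ _ = true
... | inj₂ _ | inj₁ _ = true

ListAssignment : ℕ → Set
ListAssignment n = Fin n → List ℕ

ProperColoring : {n : ℕ} → Graph n → (Fin n → ℕ) → Set
ProperColoring G c = ∀ u v → T (G u v) → c u ≢ c v

Colorable : {n : ℕ} → Graph n → ListAssignment n → Set
Colorable {n} G L = Σ (Fin n → ℕ) (λ c → ProperColoring G c × (∀ v → c v ∈ L v))

Choosable : {n : ℕ} → Graph n → (Fin n → ℕ) → Set
Choosable {n} G f = (L : ListAssignment n) →
  (∀ v → Unique (L v) × length (L v) ≡ f v) → Colorable G L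

d₁-Choosable : {n : ℕ} → Graph n → Set
d₁-Choosable G = Choosable G (λ v → degree G v ∸ 1)

-- View K₃ ∨ P₄ as a triangle with lists X, Y, Z of size 5 joined to a path 1-2-3-4 with
-- lists l₁, l₂, l₃, l₄ of sizes 3, 4, 4, 3.  It suffices to colour the path so that at most
-- two of its colours lie in X and at most three lie in Y: the triangle is then coloured
-- greedily, Z first (avoiding at most 4 path colours), then Y, then X.  Such a path colouring
-- is found by cases on which non-adjacent lists (l₁l₃, l₂l₄, l₁l₄) meet, since a repeated
-- colour saves room, and on which lists lie inside X; each failing case would put more
-- than five distinct colours into X or Y.
module Submission where

open import Defs
open import Data.Empty using (⊥; ⊥-elim)
open import Data.Fin using (Fin; zero; suc; #_; splitAt; _↑ˡ_; _↑ʳ_)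
open import Data.Fin.Properties using (splitAt⁻¹-↑ˡ; splitAt⁻¹-↑ʳ)
open import Data.List using (List; []; _∷_; _++_; length; filter)
open import Data.List.Properties using (length-++; filter-notAll)
open import Data.List.Membership.Propositional using (_∈_; _∉_; find; lose)
open import Data.List.Membership.Propositional.Properties using (∈-filter⁺; ∈-filter⁻; ∈-++⁺ˡ; ∈-++⁺ʳ; ∈-++⁻)
open import Data.List.Relation.Binary.Disjoint.Propositional using (Disjoint)
open import Data.List.Relation.Binary.Disjoint.Propositional.Properties using () renaming (sym to #-sym)
open import Data.List.Relation.Binary.Subset.Propositional using (_⊆_)
open import Data.List.Relation.Unary.All as All using (All; []; _∷_)
open import Data.List.Relation.Unary.Any as Any using (here; there; any?)
open import Data.List.Relation.Unary.Unique.Propositional using (Unique; []; _∷_)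
open import Data.List.Relation.Unary.Unique.Propositional.Properties using (++⁺; filter⁺)
open import Data.Nat using (ℕ; suc; _≤_; _<_; _∸_; _+_; _<?_; z≤n; s≤s)
open import Data.Nat.Properties using (_≟_; ≤-refl; ≤-reflexive; ≤-trans; +-mono-≤; ≤⇒≯; <⇒≱; m≤n+o⇒m∸n≤o)
open import Data.Product using (∃-syntax; _×_; _,_; proj₁; proj₂)
open import Data.Sum using (_⊎_; inj₁; inj₂; [_,_]′)
open import Function using (_∘_)
open import Relation.Binary.Definitions using (DecidableEquality)
open import Relation.Binary.PropositionalEquality using (_≡_; _≢_; refl; sym; subst)
open import Relation.Nullary using (¬_; Dec; yes; no; contradiction)
open import Relation.Nullary.Decidable using (True; toWitness; ¬?; decidable-stable)
open import Relation.Unary using (Decidable)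

module FiniteSets {a} {A : Set a} (_≟_ : DecidableEquality A) where

  open import Data.List.Membership.DecPropositional _≟_ using (_∈?_; _∉?_)

  _∖_ : List A → List A → List A
  xs ∖ ys = filter (_∉? ys) xs

  ∈-∖⁻ : ∀ {x} xs ys → x ∈ xs ∖ ys → x ∈ xs × x ∉ ys
  ∈-∖⁻ xs ys = ∈-filter⁻ (_∉? ys) {xs = xs}

  unique-∖ : ∀ {xs} ys → Unique xs → Unique (xs ∖ ys)
  unique-∖ ys = filter⁺ (_∉? ys)

  search : ∀ {p} {P : A → Set p} → Decidable P → ∀ xs →
           (∃[ x ] x ∈ xs × P x) ⊎ (∀ {x} → x ∈ xs → ¬ P x)
  search P? xs with any? P? xs
  ... | yes some = inj₁ (find some)
  ... | no none  = inj₂ λ x∈xs px → none (lose x∈xs px)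

  ⊆-or-∉ : ∀ xs ys → xs ⊆ ys ⊎ ∃[ x ] x ∈ xs × x ∉ ys
  ⊆-or-∉ xs ys with search (_∉? ys) xs
  ... | inj₁ outside = inj₂ outside
  ... | inj₂ none    = inj₁ λ {x} x∈xs → decidable-stable (x ∈? ys) (none x∈xs)

  -- Deleting the head x from ys, which contains it, strictly shortens ys and keeps the tail inside.
  length-mono-⊆ : ∀ {xs ys} → Unique xs → xs ⊆ ys → length xs ≤ length ys
  length-mono-⊆ {[]}     _               _     = z≤n
  length-mono-⊆ {x ∷ xs} {ys} (x∉xs ∷ uxs) x∷xs⊆ys =
    ≤-trans (s≤s (length-mono-⊆ uxs xs⊆ys-x))
            (filter-notAll (λ y → ¬? (x ≟ y)) ys (Any.map (λ x≡y x≢y → x≢y x≡y) (x∷xs⊆ys (here refl))))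
    where
    xs⊆ys-x : xs ⊆ filter (λ y → ¬? (x ≟ y)) ys
    xs⊆ys-x y∈xs = ∈-filter⁺ (λ y → ¬? (x ≟ y)) (x∷xs⊆ys (there y∈xs)) (All.lookup x∉xs y∈xs)

  ∃-∉ : ∀ {xs ys} → Unique xs → length ys < length xs → ∃[ x ] x ∈ xs × x ∉ ys
  ∃-∉ {xs} {ys} uxs ys<xs with ⊆-or-∉ xs ys
  ... | inj₁ xs⊆ys  = contradiction (length-mono-⊆ uxs xs⊆ys) (<⇒≱ ys<xs)
  ... | inj₂ outside = outside

  pick : ∀ {xs} ys {n} → Unique xs → n ≤ length xs → {True (length ys <? n)} → ∃[ x ] x ∈ xs × x ∉ ys
  pick ys uxs n≤xs {ys<n} = ∃-∉ uxs (≤-trans (toWitness ys<n) n≤xs)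

  length-∖ : ∀ {xs} ys {n} → Unique xs → n ≤ length xs → n ∸ length ys ≤ length (xs ∖ ys)
  length-∖ {xs} ys {n} uxs n≤xs =
    m≤n+o⇒m∸n≤o n (length ys) (≤-trans n≤xs (subst (length xs ≤_) (length-++ ys) (length-mono-⊆ uxs split)))
    where
    split : xs ⊆ ys ++ (xs ∖ ys)
    split {x} x∈xs with x ∈? ys
    ... | yes x∈ys = ∈-++⁺ˡ x∈ys
    ... | no  x∉ys = ∈-++⁺ʳ ys (∈-filter⁺ (_∉? ys) x∈xs x∉ys)

  overflow : ∀ {xs ys zs m n k} → Unique xs → Unique ys → Disjoint xs ys → xs ⊆ zs → ys ⊆ zs →
             m ≤ length xs → n ≤ length ys → length zs ≤ k → {True (k <? m + n)} → ⊥
  overflow {xs} {ys} {zs} {m} {n} uxs uys xs#ys xs⊆zs ys⊆zs m≤xs n≤ys zs≤k {k<m+n} =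
    ≤⇒≯ (≤-trans (+-mono-≤ m≤xs n≤ys) (≤-trans (subst (_≤ length zs) (length-++ xs) union≤zs) zs≤k))
        (toWitness k<m+n)
    where
    union≤zs : length (xs ++ ys) ≤ length zs
    union≤zs = length-mono-⊆ (++⁺ uxs uys xs#ys) ([ xs⊆zs , ys⊆zs ]′ ∘ ∈-++⁻ xs)

  ∉⇒≢ : ∀ {x y : A} {xs} → x ∉ xs → y ∈ xs → x ≢ y
  ∉⇒≢ x∉xs y∈xs refl = x∉xs y∈xs

  common-or-disjoint : ∀ xs ys → (∃[ x ] x ∈ xs × x ∈ ys) ⊎ Disjoint xs ys
  common-or-disjoint xs ys with search (_∈? ys) xs
  ... | inj₁ common = inj₁ common
  ... | inj₂ none   = inj₂ λ (x∈xs , x∈ys) → none x∈xs x∈ys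

  -- At most k distinct entries of cs lie in X.
  AtMostIn : ℕ → List A → List A → Set a
  AtMostIn k X cs = ∃[ U ] length U ≤ k × All (λ c → c ∈ X → c ∈ U) cs

  atMostIn-length : ∀ X cs → AtMostIn (length cs) X cs
  atMostIn-length X cs = cs , ≤-refl , All.tabulate (λ c∈cs _ → c∈cs)

  atMostIn-∷ : ∀ {k X cs c} → AtMostIn k X cs → AtMostIn (suc k) X (c ∷ cs)
  atMostIn-∷ (U , U≤k , cover) = _ ∷ U , s≤s U≤k , (λ _ → here refl) ∷ All.map (there ∘_) cover

  ∃-∉-atMostIn : ∀ {k X cs} → Unique X → k < length X → AtMostIn k X cs → ∃[ x ] x ∈ X × x ∉ cs
  ∃-∉-atMostIn uX k<X (U , U≤k , cover) with ∃-∉ uX (≤-trans (s≤s U≤k) k<X)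
  ... | x , x∈X , x∉U = x , x∈X , λ x∈cs → x∉U (All.lookup cover x∈cs x∈X)

open FiniteSets _≟_
open import Data.List.Membership.DecPropositional _≟_ using (_∈?_)

join-colourable : ∀ {m n} {A : Graph m} {B : Graph n} (L : ListAssignment (m + n))
  {cA : Fin m → ℕ} {cB : Fin n → ℕ} → ProperColoring A cA → ProperColoring B cB →
  (∀ i j → cA i ≢ cB j) → (∀ i → cA i ∈ L (i ↑ˡ n)) → (∀ j → cB j ∈ L (m ↑ʳ j)) →
  Colorable (join A B) L
join-colourable {m} {n} {A} {B} L {cA} {cB} properA properB cA≢cB cA∈L cB∈L = colour , proper , colour∈L
  where
  colour : Fin (m + n) → ℕ
  colour x = [ cA , cB ]′ (splitAt m x)

  proper : ProperColoring (join A B) colour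
  proper x y with splitAt m x | splitAt m y
  ... | inj₁ i | inj₁ j = properA i j
  ... | inj₂ i | inj₂ j = properB i j
  ... | inj₁ i | inj₂ j = λ _ → cA≢cB i j
  ... | inj₂ i | inj₁ j = λ _ → cA≢cB j i ∘ sym

  colour∈L : ∀ x → colour x ∈ L x
  colour∈L x with splitAt m x in eq
  ... | inj₁ i = subst (λ y → cA i ∈ L y) (splitAt⁻¹-↑ˡ eq) (cA∈L i)
  ... | inj₂ j = subst (λ y → cB j ∈ L y) (splitAt⁻¹-↑ʳ eq) (cB∈L j)

complete₃-avoiding : ∀ {cs} (L : ListAssignment 3) → (∀ i → Unique (L i)) → (∀ i → 4 < length (L i)) →
  AtMostIn 2 (L zero) cs → AtMostIn 3 (L (suc zero)) cs → AtMostIn 4 (L (suc (suc zero))) cs →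
  ∃[ a ] ProperColoring (complete 3) a × (∀ i → a i ∈ L i) × (∀ i → a i ∉ cs)
complete₃-avoiding {cs} L unique long few₀ few₁ few₂
  with a₂ , a₂∈L , a₂∉cs ← ∃-∉-atMostIn (unique _) (long _) few₂
  with a₁ , a₁∈L , a₁∉ ← ∃-∉-atMostIn (unique _) (long _) (atMostIn-∷ {c = a₂} few₁)
  with a₀ , a₀∈L , a₀∉ ← ∃-∉-atMostIn (unique _) (long _) (atMostIn-∷ {c = a₁} (atMostIn-∷ {c = a₂} few₀))
  = a , proper , a∈L , a∉cs
  where
  a : Fin 3 → ℕ
  a zero = a₀
  a (suc zero) = a₁
  a (suc (suc zero)) = a₂

  proper : ProperColoring (complete 3) a
  proper zero (suc zero) _ = a₀∉ ∘ here
  proper zero (suc (suc zero)) _ = a₀∉ ∘ there ∘ here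
  proper (suc zero) zero _ = a₀∉ ∘ here ∘ sym
  proper (suc zero) (suc (suc zero)) _ = a₁∉ ∘ here
  proper (suc (suc zero)) zero _ = a₀∉ ∘ there ∘ here ∘ sym
  proper (suc (suc zero)) (suc zero) _ = a₁∉ ∘ here ∘ sym
  proper zero zero ()
  proper (suc zero) (suc zero) ()
  proper (suc (suc zero)) (suc (suc zero)) ()

  a∈L : ∀ i → a i ∈ L i
  a∈L zero = a₀∈L
  a∈L (suc zero) = a₁∈L
  a∈L (suc (suc zero)) = a₂∈L

  a∉cs : ∀ i → a i ∉ cs
  a∉cs zero = a₀∉ ∘ there ∘ there
  a∉cs (suc zero) = a₁∉ ∘ there
  a∉cs (suc (suc zero)) = a₂∉cs

record PathLists (l₁ l₂ l₃ l₄ X Y : List ℕ) : Set where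
  field
    unique₁ : Unique l₁
    unique₂ : Unique l₂
    unique₃ : Unique l₃
    unique₄ : Unique l₄
    long₁ : 3 ≤ length l₁
    long₂ : 4 ≤ length l₂
    long₃ : 4 ≤ length l₃
    long₄ : 3 ≤ length l₄
    shortX : length X ≤ 5
    shortY : length Y ≤ 5

reversePathLists : ∀ {l₁ l₂ l₃ l₄ X Y} → PathLists l₁ l₂ l₃ l₄ X Y → PathLists l₄ l₃ l₂ l₁ X Y
reversePathLists h = record
  { unique₁ = unique₄ ; unique₂ = unique₃ ; unique₃ = unique₂ ; unique₄ = unique₁
  ; long₁ = long₄ ; long₂ = long₃ ; long₃ = long₂ ; long₄ = long₁
  ; shortX = shortX ; shortY = shortY }
  where open PathLists h

record PathColouring (l₁ l₂ l₃ l₄ X Y : List ℕ) : Set where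
  constructor pathColouring
  field
    c₁ c₂ c₃ c₄ : ℕ
    c₁∈l₁ : c₁ ∈ l₁
    c₂∈l₂ : c₂ ∈ l₂
    c₃∈l₃ : c₃ ∈ l₃
    c₄∈l₄ : c₄ ∈ l₄
    c₁≢c₂ : c₁ ≢ c₂
    c₂≢c₃ : c₂ ≢ c₃
    c₃≢c₄ : c₃ ≢ c₄
    fewInX : AtMostIn 2 X (c₁ ∷ c₂ ∷ c₃ ∷ c₄ ∷ [])
    fewInY : AtMostIn 3 Y (c₁ ∷ c₂ ∷ c₃ ∷ c₄ ∷ [])

reversePathColouring : ∀ {l₁ l₂ l₃ l₄ X Y} → PathColouring l₄ l₃ l₂ l₁ X Y → PathColouring l₁ l₂ l₃ l₄ X Y
reversePathColouring (pathColouring c₁ c₂ c₃ c₄ c₁∈ c₂∈ c₃∈ c₄∈ c₁≢c₂ c₂≢c₃ c₃≢c₄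
                        (U , U≤2 , u₁ ∷ u₂ ∷ u₃ ∷ u₄ ∷ []) (V , V≤3 , v₁ ∷ v₂ ∷ v₃ ∷ v₄ ∷ [])) =
  pathColouring c₄ c₃ c₂ c₁ c₄∈ c₃∈ c₂∈ c₁∈ (c₃≢c₄ ∘ sym) (c₂≢c₃ ∘ sym) (c₁≢c₂ ∘ sym)
    (U , U≤2 , u₄ ∷ u₃ ∷ u₂ ∷ u₁ ∷ []) (V , V≤3 , v₄ ∷ v₃ ∷ v₂ ∷ v₁ ∷ [])

first : ∀ {Z : List ℕ} {u us} → u ∈ Z → u ∈ u ∷ us
first _ = here refl

second : ∀ {Z : List ℕ} {u v us} → v ∈ Z → v ∈ u ∷ v ∷ us
second _ = there (here refl)

third : ∀ {Z : List ℕ} {u v w us} → w ∈ Z → w ∈ u ∷ v ∷ w ∷ us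
third _ = there (there (here refl))

outside : ∀ {Z U : List ℕ} {c} → c ∉ Z → c ∈ Z → c ∈ U
outside c∉Z c∈Z = contradiction c∈Z c∉Z

module _ {l₁ l₂ l₃ l₄ X Y : List ℕ} (h : PathLists l₁ l₂ l₃ l₄ X Y) where
  open PathLists h

  sharedOddColour : ∀ {c} → c ∈ l₁ → c ∈ l₃ → PathColouring l₁ l₂ l₃ l₄ X Y
  sharedOddColour {c} c∈l₁ c∈l₃ = byX (c ∈? X)
    where
    colour : ∀ {x y} → x ∈ l₂ → x ≢ c → y ∈ l₄ → y ≢ c →
             AtMostIn 2 X (c ∷ x ∷ c ∷ y ∷ []) → PathColouring l₁ l₂ l₃ l₄ X Y
    colour {x} {y} x∈l₂ x≢c y∈l₄ y≢c fewInX =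
      pathColouring c x c y c∈l₁ x∈l₂ c∈l₃ y∈l₄ (x≢c ∘ sym) x≢c (y≢c ∘ sym) fewInX
        (c ∷ x ∷ y ∷ [] , ≤-refl , first ∷ second ∷ first ∷ third ∷ [])

    byX : Dec (c ∈ X) → PathColouring l₁ l₂ l₃ l₄ X Y
    byX (no c∉X) =
      let x , x∈l₂ , x∉c = pick (c ∷ []) unique₂ long₂
          y , y∈l₄ , y∉c = pick (c ∷ []) unique₄ long₄
      in colour x∈l₂ (x∉c ∘ here) y∈l₄ (y∉c ∘ here)
           (x ∷ y ∷ [] , ≤-refl , outside c∉X ∷ first ∷ outside c∉X ∷ second ∷ [])
    byX (yes c∈X) with ⊆-or-∉ l₂ X | ⊆-or-∉ l₄ X
    ... | inj₂ (x , x∈l₂ , x∉X) | _ =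
      let y , y∈l₄ , y∉c = pick (c ∷ []) unique₄ long₄
      in colour x∈l₂ (∉⇒≢ x∉X c∈X) y∈l₄ (y∉c ∘ here)
           (c ∷ y ∷ [] , ≤-refl , first ∷ outside x∉X ∷ first ∷ second ∷ [])
    ... | _ | inj₂ (y , y∈l₄ , y∉X) =
      let x , x∈l₂ , x∉c = pick (c ∷ []) unique₂ long₂
      in colour x∈l₂ (x∉c ∘ here) y∈l₄ (∉⇒≢ y∉X c∈X)
           (c ∷ x ∷ [] , ≤-refl , first ∷ second ∷ first ∷ outside y∉X ∷ [])
    ... | inj₁ l₂⊆X | inj₁ l₄⊆X with search (_∈? (l₄ ∖ (c ∷ []))) l₂
    ...   | inj₁ (d , d∈l₂ , d∈l₄-c) =
      let d∈l₄ , d∉c = ∈-∖⁻ l₄ (c ∷ []) d∈l₄-c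
      in colour d∈l₂ (d∉c ∘ here) d∈l₄ (d∉c ∘ here) (c ∷ d ∷ [] , ≤-refl , first ∷ second ∷ first ∷ second ∷ [])
    ...   | inj₂ none =
      ⊥-elim (overflow unique₂ (unique-∖ (c ∷ []) unique₄) (λ (d∈l₂ , d∈l₄-c) → none d∈l₂ d∈l₄-c)
                       l₂⊆X (l₄⊆X ∘ proj₁ ∘ ∈-∖⁻ l₄ (c ∷ [])) long₂ (length-∖ (c ∷ []) unique₄ long₄) shortX)

  innerOverflow : l₂ ⊆ X → l₂ ⊆ Y → ∀ {a b} → a ∉ X → b ∉ X → a ≢ b → a ∈ Y → b ∈ Y → ⊥
  innerOverflow l₂⊆X l₂⊆Y {a} {b} a∉X b∉X a≢b a∈Y b∈Y =
    overflow unique₂ ((a≢b ∷ []) ∷ [] ∷ []) l₂#ab l₂⊆Y ab⊆Y long₂ ≤-refl shortY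
    where
    l₂#ab : Disjoint l₂ (a ∷ b ∷ [])
    l₂#ab (z∈l₂ , here refl)         = a∉X (l₂⊆X z∈l₂)
    l₂#ab (z∈l₂ , there (here refl)) = b∉X (l₂⊆X z∈l₂)

    ab⊆Y : a ∷ b ∷ [] ⊆ Y
    ab⊆Y (here refl)         = a∈Y
    ab⊆Y (there (here refl)) = b∈Y

  innersInX : Disjoint l₁ l₃ → Disjoint l₂ l₄ → l₂ ⊆ X → l₃ ⊆ X → PathColouring l₁ l₂ l₃ l₄ X Y
  innersInX l₁#l₃ l₂#l₄ l₂⊆X l₃⊆X with ⊆-or-∉ l₁ X | ⊆-or-∉ l₄ X
  ... | inj₁ l₁⊆X | _ = ⊥-elim (overflow unique₁ unique₃ l₁#l₃ l₁⊆X l₃⊆X long₁ long₃ shortX)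
  ... | _ | inj₁ l₄⊆X = ⊥-elim (overflow unique₂ unique₄ l₂#l₄ l₂⊆X l₄⊆X long₂ long₄ shortX)
  ... | inj₂ (f , f∈l₁ , f∉X) | inj₂ (g , g∈l₄ , g∉X) = byY
    where
    colour : ∀ {x y} → x ∈ l₂ → y ∈ l₃ → x ≢ y →
             AtMostIn 3 Y (f ∷ x ∷ y ∷ g ∷ []) → PathColouring l₁ l₂ l₃ l₄ X Y
    colour {x} {y} x∈l₂ y∈l₃ x≢y fewInY =
      pathColouring f x y g f∈l₁ x∈l₂ y∈l₃ g∈l₄
        (∉⇒≢ f∉X (l₂⊆X x∈l₂)) x≢y (∉⇒≢ g∉X (l₃⊆X y∈l₃) ∘ sym)
        (x ∷ y ∷ [] , ≤-refl , outside f∉X ∷ first ∷ second ∷ outside g∉X ∷ []) fewInY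

    byY : PathColouring l₁ l₂ l₃ l₄ X Y
    byY
      with x , x∈l₂ , _ ← pick [] unique₂ long₂
      with y , y∈l₃ , y∉x ← pick (x ∷ []) unique₃ long₃
      with f ≟ g | f ∈? Y | g ∈? Y | ⊆-or-∉ l₂ Y
    ... | yes refl | _ | _ | _ =
      colour x∈l₂ y∈l₃ (y∉x ∘ here ∘ sym) (f ∷ x ∷ y ∷ [] , ≤-refl , first ∷ second ∷ third ∷ first ∷ [])
    ... | no _ | no f∉Y | _ | _ =
      colour x∈l₂ y∈l₃ (y∉x ∘ here ∘ sym) (x ∷ y ∷ g ∷ [] , ≤-refl , outside f∉Y ∷ first ∷ second ∷ third ∷ [])
    ... | no _ | _ | no g∉Y | _ =
      colour x∈l₂ y∈l₃ (y∉x ∘ here ∘ sym) (f ∷ x ∷ y ∷ [] , ≤-refl , first ∷ second ∷ third ∷ outside g∉Y ∷ [])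
    ... | no _ | _ | _ | inj₂ (x′ , x′∈l₂ , x′∉Y) =
      let y′ , y′∈l₃ , y′∉x′ = pick (x′ ∷ []) unique₃ long₃
      in colour x′∈l₂ y′∈l₃ (y′∉x′ ∘ here ∘ sym)
           (f ∷ y′ ∷ g ∷ [] , ≤-refl , first ∷ outside x′∉Y ∷ second ∷ third ∷ [])
    ... | no f≢g | yes f∈Y | yes g∈Y | inj₁ l₂⊆Y = ⊥-elim (innerOverflow l₂⊆X l₂⊆Y f∉X g∉X f≢g f∈Y g∈Y)

  sharedEndColour : Disjoint l₁ l₃ → Disjoint l₂ l₄ → ∀ {e} → e ∈ l₁ → e ∈ l₄ → PathColouring l₁ l₂ l₃ l₄ X Y
  sharedEndColour l₁#l₃ l₂#l₄ {e} e∈l₁ e∈l₄ = byX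
    where
    colour : ∀ {x y} → x ∈ l₂ → y ∈ l₃ → x ≢ y →
             AtMostIn 2 X (e ∷ x ∷ y ∷ e ∷ []) → PathColouring l₁ l₂ l₃ l₄ X Y
    colour {x} {y} x∈l₂ y∈l₃ x≢y fewInX =
      pathColouring e x y e e∈l₁ x∈l₂ y∈l₃ e∈l₄
        (λ { refl → l₂#l₄ (x∈l₂ , e∈l₄) }) x≢y (λ { refl → l₁#l₃ (e∈l₁ , y∈l₃) })
        fewInX (e ∷ x ∷ y ∷ [] , ≤-refl , first ∷ second ∷ third ∷ first ∷ [])

    byX : PathColouring l₁ l₂ l₃ l₄ X Y
    byX with e ∈? X | ⊆-or-∉ l₂ X | ⊆-or-∉ l₃ X
    ... | no e∉X | _ | _ =
      let x , x∈l₂ , _ = pick [] unique₂ long₂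
          y , y∈l₃ , y∉x = pick (x ∷ []) unique₃ long₃
      in colour x∈l₂ y∈l₃ (y∉x ∘ here ∘ sym)
           (x ∷ y ∷ [] , ≤-refl , outside e∉X ∷ first ∷ second ∷ outside e∉X ∷ [])
    ... | yes _ | inj₂ (x , x∈l₂ , x∉X) | _ =
      let y , y∈l₃ , y∉x = pick (x ∷ []) unique₃ long₃
      in colour x∈l₂ y∈l₃ (y∉x ∘ here ∘ sym)
           (e ∷ y ∷ [] , ≤-refl , first ∷ outside x∉X ∷ second ∷ first ∷ [])
    ... | yes _ | _ | inj₂ (y , y∈l₃ , y∉X) =
      let x , x∈l₂ , x∉y = pick (y ∷ []) unique₂ long₂
      in colour x∈l₂ y∈l₃ (x∉y ∘ here)
           (e ∷ x ∷ [] , ≤-refl , first ∷ second ∷ outside y∉X ∷ first ∷ [])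
    ... | yes _ | inj₁ l₂⊆X | inj₁ l₃⊆X = innersInX l₁#l₃ l₂#l₄ l₂⊆X l₃⊆X

  oddsOutsideX : Disjoint l₂ l₄ → ∀ {c₁ c₃} → c₁ ∈ l₁ → c₁ ∉ X → c₃ ∈ l₃ → c₃ ∉ X →
                 PathColouring l₁ l₂ l₃ l₄ X Y
  oddsOutsideX l₂#l₄ {c₁} {c₃} c₁∈l₁ c₁∉X c₃∈l₃ c₃∉X = byY
    where
    colour : ∀ {x y} → x ∈ l₂ → x ≢ c₁ → x ≢ c₃ → y ∈ l₄ → y ≢ c₃ →
             AtMostIn 3 Y (c₁ ∷ x ∷ c₃ ∷ y ∷ []) → PathColouring l₁ l₂ l₃ l₄ X Y
    colour {x} {y} x∈l₂ x≢c₁ x≢c₃ y∈l₄ y≢c₃ fewInY =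
      pathColouring c₁ x c₃ y c₁∈l₁ x∈l₂ c₃∈l₃ y∈l₄ (x≢c₁ ∘ sym) x≢c₃ (y≢c₃ ∘ sym)
        (x ∷ y ∷ [] , ≤-refl , outside c₁∉X ∷ first ∷ outside c₃∉X ∷ second ∷ []) fewInY

    byY : PathColouring l₁ l₂ l₃ l₄ X Y
    byY
      with x , x∈l₂ , x∉c₁c₃ ← pick (c₁ ∷ c₃ ∷ []) unique₂ long₂
      with y , y∈l₄ , y∉c₃ ← pick (c₃ ∷ []) unique₄ long₄
      with c₁ ∈? Y | c₃ ∈? Y | ⊆-or-∉ l₂ Y | ⊆-or-∉ l₄ Y
    ... | no c₁∉Y | _ | _ | _ =
      colour x∈l₂ (x∉c₁c₃ ∘ here) (x∉c₁c₃ ∘ there ∘ here) y∈l₄ (y∉c₃ ∘ here)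
        (x ∷ c₃ ∷ y ∷ [] , ≤-refl , outside c₁∉Y ∷ first ∷ second ∷ third ∷ [])
    ... | _ | no c₃∉Y | _ | _ =
      colour x∈l₂ (x∉c₁c₃ ∘ here) (x∉c₁c₃ ∘ there ∘ here) y∈l₄ (y∉c₃ ∘ here)
        (c₁ ∷ x ∷ y ∷ [] , ≤-refl , first ∷ second ∷ outside c₃∉Y ∷ third ∷ [])
    ... | yes c₁∈Y | yes c₃∈Y | inj₂ (x′ , x′∈l₂ , x′∉Y) | _ =
      colour x′∈l₂ (∉⇒≢ x′∉Y c₁∈Y) (∉⇒≢ x′∉Y c₃∈Y) y∈l₄ (y∉c₃ ∘ here)
        (c₁ ∷ c₃ ∷ y ∷ [] , ≤-refl , first ∷ outside x′∉Y ∷ second ∷ third ∷ [])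
    ... | yes _ | yes c₃∈Y | _ | inj₂ (y′ , y′∈l₄ , y′∉Y) =
      colour x∈l₂ (x∉c₁c₃ ∘ here) (x∉c₁c₃ ∘ there ∘ here) y′∈l₄ (∉⇒≢ y′∉Y c₃∈Y)
        (c₁ ∷ x ∷ c₃ ∷ [] , ≤-refl , first ∷ second ∷ third ∷ outside y′∉Y ∷ [])
    ... | yes _ | yes _ | inj₁ l₂⊆Y | inj₁ l₄⊆Y =
      ⊥-elim (overflow unique₂ unique₄ l₂#l₄ l₂⊆Y l₄⊆Y long₂ long₄ shortY)

  firstTwoInX : Disjoint l₁ l₃ → Disjoint l₂ l₄ → l₁ ⊆ X → l₂ ⊆ X → PathColouring l₁ l₂ l₃ l₄ X Y
  firstTwoInX l₁#l₃ l₂#l₄ l₁⊆X l₂⊆X with ⊆-or-∉ l₃ X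
  ... | inj₁ l₃⊆X = ⊥-elim (overflow unique₁ unique₃ l₁#l₃ l₁⊆X l₃⊆X long₁ long₃ shortX)
  ... | inj₂ (c₃ , c₃∈l₃ , c₃∉X) with ⊆-or-∉ (l₄ ∖ (c₃ ∷ [])) X
  ...   | inj₁ l₄-c₃⊆X =
    ⊥-elim (overflow unique₂ (unique-∖ (c₃ ∷ []) unique₄)
                     (λ (z∈l₂ , z∈l₄-c₃) → l₂#l₄ (z∈l₂ , proj₁ (∈-∖⁻ l₄ (c₃ ∷ []) z∈l₄-c₃)))
                     l₂⊆X l₄-c₃⊆X long₂ (length-∖ (c₃ ∷ []) unique₄ long₄) shortX)
  ...   | inj₂ (c₄ , c₄∈l₄-c₃ , c₄∉X) = byY
    where
    c₄∈l₄ : c₄ ∈ l₄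
    c₄∈l₄ = proj₁ (∈-∖⁻ l₄ (c₃ ∷ []) c₄∈l₄-c₃)

    c₃≢c₄ : c₃ ≢ c₄
    c₃≢c₄ refl = proj₂ (∈-∖⁻ l₄ (c₃ ∷ []) c₄∈l₄-c₃) (here refl)

    colour : ∀ {w x} → w ∈ l₁ → x ∈ l₂ → w ≢ x →
             AtMostIn 3 Y (w ∷ x ∷ c₃ ∷ c₄ ∷ []) → PathColouring l₁ l₂ l₃ l₄ X Y
    colour {w} {x} w∈l₁ x∈l₂ w≢x fewInY =
      pathColouring w x c₃ c₄ w∈l₁ x∈l₂ c₃∈l₃ c₄∈l₄ w≢x (∉⇒≢ c₃∉X (l₂⊆X x∈l₂) ∘ sym) c₃≢c₄
        (w ∷ x ∷ [] , ≤-refl , first ∷ second ∷ outside c₃∉X ∷ outside c₄∉X ∷ []) fewInY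

    byY : PathColouring l₁ l₂ l₃ l₄ X Y
    byY
      with x , x∈l₂ , _ ← pick [] unique₂ long₂
      with w , w∈l₁ , w∉x ← pick (x ∷ []) unique₁ long₁
      with c₃ ∈? Y | c₄ ∈? Y | ⊆-or-∉ l₂ Y
    ... | no c₃∉Y | _ | _ =
      colour w∈l₁ x∈l₂ (w∉x ∘ here) (w ∷ x ∷ c₄ ∷ [] , ≤-refl , first ∷ second ∷ outside c₃∉Y ∷ third ∷ [])
    ... | _ | no c₄∉Y | _ =
      colour w∈l₁ x∈l₂ (w∉x ∘ here) (w ∷ x ∷ c₃ ∷ [] , ≤-refl , first ∷ second ∷ third ∷ outside c₄∉Y ∷ [])
    ... | _ | _ | inj₂ (x′ , x′∈l₂ , x′∉Y) =
      let w′ , w′∈l₁ , w′∉x′ = pick (x′ ∷ []) unique₁ long₁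
      in colour w′∈l₁ x′∈l₂ (w′∉x′ ∘ here)
           (w′ ∷ c₃ ∷ c₄ ∷ [] , ≤-refl , first ∷ outside x′∉Y ∷ second ∷ third ∷ [])
    ... | yes c₃∈Y | yes c₄∈Y | inj₁ l₂⊆Y = ⊥-elim (innerOverflow l₂⊆X l₂⊆Y c₃∉X c₄∉X c₃≢c₄ c₃∈Y c₄∈Y)

pathColouring-exists : ∀ {l₁ l₂ l₃ l₄ X Y} → PathLists l₁ l₂ l₃ l₄ X Y → PathColouring l₁ l₂ l₃ l₄ X Y
pathColouring-exists {l₁} {l₂} {l₃} {l₄} {X} h
  with common-or-disjoint l₁ l₃ | common-or-disjoint l₂ l₄ | common-or-disjoint l₁ l₄
... | inj₁ (c , c∈l₁ , c∈l₃) | _ | _ = sharedOddColour h c∈l₁ c∈l₃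
... | _ | inj₁ (c , c∈l₂ , c∈l₄) | _ = reversePathColouring (sharedOddColour (reversePathLists h) c∈l₄ c∈l₂)
... | inj₂ l₁#l₃ | inj₂ l₂#l₄ | inj₁ (e , e∈l₁ , e∈l₄) = sharedEndColour h l₁#l₃ l₂#l₄ e∈l₁ e∈l₄
... | inj₂ l₁#l₃ | inj₂ l₂#l₄ | inj₂ l₁#l₄
  -- Unless l₁, l₃ or l₂, l₄ both leave X, one list of each pair lies in X (and not both of l₁, l₄).
  with ⊆-or-∉ l₁ X | ⊆-or-∉ l₂ X | ⊆-or-∉ l₃ X | ⊆-or-∉ l₄ X
...   | inj₂ (c₁ , c₁∈l₁ , c₁∉X) | _ | inj₂ (c₃ , c₃∈l₃ , c₃∉X) | _ =
  oddsOutsideX h l₂#l₄ c₁∈l₁ c₁∉X c₃∈l₃ c₃∉X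
...   | _ | inj₂ (c₂ , c₂∈l₂ , c₂∉X) | _ | inj₂ (c₄ , c₄∈l₄ , c₄∉X) =
  reversePathColouring (oddsOutsideX (reversePathLists h) (#-sym l₁#l₃) c₄∈l₄ c₄∉X c₂∈l₂ c₂∉X)
...   | inj₁ l₁⊆X | inj₁ l₂⊆X | _ | _ = firstTwoInX h l₁#l₃ l₂#l₄ l₁⊆X l₂⊆X
...   | _ | _ | inj₁ l₃⊆X | inj₁ l₄⊆X =
  reversePathColouring (firstTwoInX (reversePathLists h) (#-sym l₂#l₄) (#-sym l₁#l₃) l₄⊆X l₃⊆X)
...   | _ | inj₁ l₂⊆X | inj₁ l₃⊆X | _ = innersInX h l₁#l₃ l₂#l₄ l₂⊆X l₃⊆X
...   | inj₁ l₁⊆X | _ | _ | inj₁ l₄⊆X = ⊥-elim (overflow unique₁ unique₄ l₁#l₄ l₁⊆X l₄⊆X long₁ long₄ shortX)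
  where open PathLists h

module _ {X Y} (L : ListAssignment 4) (P : PathColouring (L zero) (L (suc zero)) (L (suc (suc zero))) (L (suc (suc (suc zero)))) X Y) where
  open PathColouring P

  colours : List ℕ
  colours = c₁ ∷ c₂ ∷ c₃ ∷ c₄ ∷ []

  colour : Fin 4 → ℕ
  colour zero                   = c₁
  colour (suc zero)             = c₂
  colour (suc (suc zero))       = c₃
  colour (suc (suc (suc zero))) = c₄

  colour∈colours : ∀ j → colour j ∈ colours
  colour∈colours zero                   = here refl
  colour∈colours (suc zero)             = there (here refl)
  colour∈colours (suc (suc zero))       = there (there (here refl))
  colour∈colours (suc (suc (suc zero))) = there (there (there (here refl)))

  colour∈L : ∀ j → colour j ∈ L j
  colour∈L zero                   = c₁∈l₁
  colour∈L (suc zero)             = c₂∈l₂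
  colour∈L (suc (suc zero))       = c₃∈l₃
  colour∈L (suc (suc (suc zero))) = c₄∈l₄

  colour-proper : ProperColoring (path 4) colour
  colour-proper zero (suc zero) _ = c₁≢c₂
  colour-proper (suc zero) zero _ = c₁≢c₂ ∘ sym
  colour-proper (suc zero) (suc (suc zero)) _ = c₂≢c₃
  colour-proper (suc (suc zero)) (suc zero) _ = c₂≢c₃ ∘ sym
  colour-proper (suc (suc zero)) (suc (suc (suc zero))) _ = c₃≢c₄
  colour-proper (suc (suc (suc zero))) (suc (suc zero)) _ = c₃≢c₄ ∘ sym
  colour-proper zero zero ()
  colour-proper zero (suc (suc zero)) ()
  colour-proper zero (suc (suc (suc zero))) ()
  colour-proper (suc zero) (suc zero) ()
  colour-proper (suc zero) (suc (suc (suc zero))) ()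
  colour-proper (suc (suc zero)) zero ()
  colour-proper (suc (suc zero)) (suc (suc zero)) ()
  colour-proper (suc (suc (suc zero))) zero ()
  colour-proper (suc (suc (suc zero))) (suc zero) ()
  colour-proper (suc (suc (suc zero))) (suc (suc (suc zero))) ()

mainTheorem15 : d₁-Choosable (join (complete 3) (path 4))
mainTheorem15 L H =
  let a , a-proper , a∈L , a∉colours =
        complete₃-avoiding (λ i → L (i ↑ˡ 4)) (λ i → unique (i ↑ˡ 4)) clique-long
          (PathColouring.fewInX P) (PathColouring.fewInY P) (atMostIn-length _ (colours Lᴾ P))
  in join-colourable L a-proper (colour-proper Lᴾ P)
       (λ i j → ∉⇒≢ (a∉colours i) (colour∈colours Lᴾ P j)) a∈L (colour∈L Lᴾ P)
  where
  unique : ∀ v → Unique (L v)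
  unique = proj₁ ∘ H

  size : ∀ v → length (L v) ≡ degree (join (complete 3) (path 4)) v ∸ 1
  size = proj₂ ∘ H

  -- The degrees are 6 on the triangle and 4, 5, 5, 4 along the path.
  clique-long : ∀ i → 4 < length (L (i ↑ˡ 4))
  clique-long zero             = ≤-reflexive (sym (size (# 0)))
  clique-long (suc zero)       = ≤-reflexive (sym (size (# 1)))
  clique-long (suc (suc zero)) = ≤-reflexive (sym (size (# 2)))

  Lᴾ : ListAssignment 4
  Lᴾ j = L (3 ↑ʳ j)

  P : PathColouring (L (# 3)) (L (# 4)) (L (# 5)) (L (# 6)) (L (# 0)) (L (# 1))
  P = pathColouring-exists record
    { unique₁ = unique (# 3) ; unique₂ = unique (# 4) ; unique₃ = unique (# 5) ; unique₄ = unique (# 6)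
    ; long₁ = ≤-reflexive (sym (size (# 3))) ; long₂ = ≤-reflexive (sym (size (# 4)))
    ; long₃ = ≤-reflexive (sym (size (# 5))) ; long₄ = ≤-reflexive (sym (size (# 6)))
    ; shortX = ≤-reflexive (size (# 0)) ; shortY = ≤-reflexive (size (# 1)) }
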